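{- Let $G$ be a finite simple bipartite graph with $v(G)$ vertices and $e(G)$ edges. Then the nim-value $g(G)$ of $G$ in graph chomp is: $0$ if $v(G)$ and $e(G)$ are both even; $2$ if $v(G)$ is even and $e(G)$ is odd; $1$ if $v(G)$ is odd and $e(G)$ is even; $3$ if $v(G)$ and $e(G)$ are both odd.
   Context: A graph is bipartite if its vertex set can be split into two groups so that no edge joins two vertices of the same group. Graph chomp is played on a finite simple graph: two players alternate, and a move consists either of deleting one edge, or of deleting one vertex together with all edges incident to it. The player who makes the last move wins. The nim-value $g$ of a position is defined recursively: the empty graph has nim-value $0$, and $g(G)$ is the minimal nonnegative integer not equal to the nim-value of any position reachable from $G$ in one move. -}

module Defs where

open import Data.Nat using (ℕ; zero; suc; _+_; _<_; _≡ᵇ_)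
open import Data.Bool using (Bool; true; false; if_then_else_)
open import Data.Fin using (Fin; toℕ; punchOut; _≟_)
open import Data.Fin.Base using () renaming (zero to fz; suc to fs)
open import Data.List using (List; []; _∷_; map; length; mapMaybe; allFin; _++_)
open import Data.Bool.ListAction using (any)
open import Data.List.Relation.Unary.All using (All)
open import Data.List.Relation.Unary.Unique.Propositional using (Unique)
open import Data.Maybe using (Maybe; just; nothing)
open import Data.Product using (_×_; _,_; Σ)
open import Relation.Nullary using (yes; no; ¬_)
open import Relation.Binary.PropositionalEquality using (_≡_)

-- A finite graph on the vertex set Fin n, given by its list of edges.
-- An edge {i , j} is stored canonically as the ordered pair (i , j) with i < j.
Edges : ℕ → Set
Edges n = List (Fin n × Fin n)

Simple : {n : ℕ} → Edges n → Set
Simple es = All (λ e → toℕ (Data.Product.proj₁ e) < toℕ (Data.Product.proj₂ e)) es × Unique es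

Bipartite : {n : ℕ} → Edges n → Set
Bipartite {n} es = Σ (Fin n → Bool) λ c →
  All (λ e → ¬ (c (Data.Product.proj₁ e) ≡ c (Data.Product.proj₂ e))) es

removals : {A : Set} → List A → List (List A)
removals [] = []
removals (x ∷ xs) = xs ∷ map (x ∷_) (removals xs)

dropV : {n : ℕ} → Fin (suc n) → Fin (suc n) → Maybe (Fin n)
dropV k i with k ≟ i
... | yes _ = nothing
... | no k≢i = just (punchOut k≢i)

dropE : {n : ℕ} → Fin (suc n) → Fin (suc n) × Fin (suc n) → Maybe (Fin n × Fin n)
dropE k (i , j) with dropV k i | dropV k j
... | just i' | just j' = just (i' , j')
... | _ | _ = nothing

deleteVertex : {n : ℕ} → Fin (suc n) → Edges (suc n) → Edges n
deleteVertex k es = mapMaybe (dropE k) es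

memb : ℕ → List ℕ → Bool
memb k xs = any (λ y → k ≡ᵇ y) xs

mexFrom : ℕ → ℕ → List ℕ → ℕ
mexFrom zero k xs = k
mexFrom (suc f) k xs = if memb k xs then mexFrom f (suc k) xs else k

-- least natural number not in the list (some value ≤ length xs is missing)
mex : List ℕ → ℕ
mex xs = mexFrom (suc (length xs)) 0 xs

-- Nim-value with fuel; each move decreases (number of vertices + number
-- of edges) by at least one, so fuel (n + length es + 1) is sufficient.
nimF : ℕ → (n : ℕ) → Edges n → ℕ
nimF zero n es = 0
nimF (suc f) zero es = mex (map (nimF f zero) (removals es))
nimF (suc f) (suc n) es =
  mex (map (λ k → nimF f n (deleteVertex k es)) (allFin (suc n))
       ++ map (nimF f (suc n)) (removals es))

nim : (n : ℕ) → Edges n → ℕ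
nim n es = nimF (suc (n + length es)) n es

-- Write the claimed value as p + 2q, where p and q are the parities of the
-- numbers of vertices and of edges. Deleting an edge flips q and keeps p,
-- deleting a vertex flips p, so no option has value p + 2q; it remains to reach
-- every smaller value. When q = 1, deleting an edge gives p + 0. Deleting a
-- vertex of degree d gives (1 - p) + 2(q + d mod 2): when p = 1 the handshake
-- lemma yields a vertex of even degree, and when q = 1 summing degrees over one
-- colour class of a 2-colouring counts each edge once, which yields a vertex of
-- odd degree.
module Submission where

open import Defs
open import Algebra.Properties.Semiring.Sum as ∑ using ()
open import Data.Bool using (Bool; true; false)
open import Data.Bool.Properties using (T-≡; ¬-not)
open import Data.Empty using (⊥-elim)
open import Data.Fin using (Fin; zero; suc; punchIn; _≟_)
open import Data.Fin.Properties using (punchIn-punchOut; ¬∀⟶∃¬)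
open import Data.List using (List; []; _∷_; map; length; allFin; _++_)
open import Data.List.Properties using (length-++; length-map; length-tabulate)
open import Data.List.Membership.Propositional using (_∈_; _∉_)
open import Data.List.Membership.Propositional.Properties
  using (∈-map⁺; ∈-map⁻; ∈-++⁺ˡ; ∈-++⁺ʳ; ∈-allFin)
open import Data.List.Relation.Unary.All as All using (All; []; _∷_)
import Data.List.Relation.Unary.All.Properties as All
import Data.List.Relation.Unary.Any as Any
open import Data.List.Relation.Unary.Any using (here; there)
open import Data.List.Relation.Unary.Any.Properties using (any⁺; any⁻)
open import Data.Maybe using (just; nothing)
import Data.Maybe.Relation.Unary.All as Maybe
open import Data.Nat using (ℕ; zero; suc; _+_; _*_; _%_; _≤_; _<_; z≤n; s≤s; parity)
open import Data.Nat.Properties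
  using (≤-refl; ≤-trans; ≤-<-trans; m≤m+n; +-mono-≤; +-monoˡ-≤; +-monoʳ-≤; *-monoʳ-≤;
         +-suc; +-identityʳ; ≤∧≢⇒<; <-irrefl; ≡⇒≡ᵇ; ≡ᵇ⇒≡)
import Data.Nat.Properties as ℕ
open import Data.Parity.Base
  using (Parity; 0ℙ; 1ℙ; _⁻¹) renaming (_+_ to infixl 6 _⊕_; _*_ to infixl 7 _·_)
open import Data.Parity.Properties as ℙ using (suc-homo-⁻¹; +-homo-+; p≢p⁻¹; p+p≡0ℙ)
open import Data.Product using (_×_; _,_; ∃)
open import Data.Product.Properties using (,-injectiveˡ; ,-injectiveʳ)
open import Data.Sum using (_⊎_; inj₁; inj₂)
open import Function using (_∘_; Equivalence)
open import Relation.Nullary using (¬_; yes; no)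
open import Relation.Binary.PropositionalEquality

open ∑ ℙ.+-*-semiring using (sum-syntax; sum-cong-≗; ∑-distrib-+; sum-replicate-zero)

bit : Parity → ℕ
bit 0ℙ = 0
bit 1ℙ = 1

bit-parity : ∀ n → bit (parity n) ≡ n % 2
bit-parity 0 = refl
bit-parity 1 = refl
bit-parity (suc (suc n)) = bit-parity n

parity-suc : ∀ n → parity (suc n) ≡ parity n ⁻¹
parity-suc = +-homo-+ 1

nimValue : Parity → Parity → ℕ
nimValue p q = bit p + 2 * bit q

nimValue⁻¹ : ℕ → Parity × Parity
nimValue⁻¹ 0 = 0ℙ , 0ℙ
nimValue⁻¹ 1 = 1ℙ , 0ℙ
nimValue⁻¹ 2 = 0ℙ , 1ℙ
nimValue⁻¹ _ = 1ℙ , 1ℙ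

nimValue⁻¹-nimValue : ∀ p q → nimValue⁻¹ (nimValue p q) ≡ (p , q)
nimValue⁻¹-nimValue 0ℙ 0ℙ = refl
nimValue⁻¹-nimValue 1ℙ 0ℙ = refl
nimValue⁻¹-nimValue 0ℙ 1ℙ = refl
nimValue⁻¹-nimValue 1ℙ 1ℙ = refl

nimValue-injective : ∀ {p q p′ q′} → nimValue p q ≡ nimValue p′ q′ → (p , q) ≡ (p′ , q′)
nimValue-injective {p} {q} {p′} {q′} eq = begin
  p , q                          ≡⟨ nimValue⁻¹-nimValue p q ⟨
  nimValue⁻¹ (nimValue p q)      ≡⟨ cong nimValue⁻¹ eq ⟩
  nimValue⁻¹ (nimValue p′ q′)    ≡⟨ nimValue⁻¹-nimValue p′ q′ ⟩
  p′ , q′                        ∎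
  where open ≡-Reasoning

bit≤1 : ∀ p → bit p ≤ 1
bit≤1 0ℙ = z≤n
bit≤1 1ℙ = s≤s z≤n

2*bit-parity≤1+n : ∀ n → 2 * bit (parity n) ≤ suc n
2*bit-parity≤1+n zero = z≤n
2*bit-parity≤1+n (suc n) = ≤-trans (*-monoʳ-≤ 2 (bit≤1 (parity (suc n)))) (s≤s (s≤s z≤n))

nimValue-parity≤2+n : ∀ p n → nimValue p (parity n) ≤ 2 + n
nimValue-parity≤2+n p n = +-mono-≤ (bit≤1 p) (2*bit-parity≤1+n n)

memb-∈ : ∀ {y xs} → y ∈ xs → memb y xs ≡ true
memb-∈ {y} y∈xs = Equivalence.to T-≡ (any⁺ _ (Any.map (≡⇒≡ᵇ y _) y∈xs))

memb-∉ : ∀ {y} xs → y ∉ xs → memb y xs ≡ false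
memb-∉ {y} xs y∉xs = ¬-not λ memb≡true →
  y∉xs (Any.map (≡ᵇ⇒≡ y _) (any⁻ _ xs (Equivalence.from T-≡ memb≡true)))

mexFrom-≡ : ∀ fuel k {xs t} → k ≤ t → t < k + fuel →
  (∀ {y} → k ≤ y → y < t → y ∈ xs) → t ∉ xs → mexFrom fuel k xs ≡ t
mexFrom-≡ zero k k≤t t<k+0 _ _ =
  ⊥-elim (<-irrefl refl (≤-trans (subst (_ <_) (+-identityʳ k) t<k+0) k≤t))
mexFrom-≡ (suc fuel) k {xs} {t} k≤t t<k+1+fuel below t∉xs with k ℕ.≟ t
... | yes refl rewrite memb-∉ xs t∉xs = refl
... | no k≢t rewrite memb-∈ (below ≤-refl (≤∧≢⇒< k≤t k≢t)) =
  mexFrom-≡ fuel (suc k) (≤∧≢⇒< k≤t k≢t) (subst (t <_) (+-suc k fuel) t<k+1+fuel)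
    (λ 1+k≤y → below (≤-trans (ℕ.n≤1+n k) 1+k≤y)) t∉xs

-- The bound t ≤ length xs only serves the fuel with which mex is computed.
mex-≡ : ∀ xs t → (∀ {y} → y < t → y ∈ xs) → t ∉ xs → t ≤ length xs → mex xs ≡ t
mex-≡ xs t below t∉xs t≤∣xs∣ = mexFrom-≡ (suc (length xs)) 0 z≤n (s≤s t≤∣xs∣) (λ _ → below) t∉xs

nimValues-below : ∀ p q {xs} →
  (q ≡ 1ℙ → nimValue p (q ⁻¹) ∈ xs) →
  (q ≡ 1ℙ → nimValue (p ⁻¹) (q ⊕ 1ℙ) ∈ xs) →
  (p ≡ 1ℙ → nimValue (p ⁻¹) (q ⊕ 0ℙ) ∈ xs) →
  ∀ {y} → y < nimValue p q → y ∈ xs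
nimValues-below 1ℙ 0ℙ edge odd even {0} _ = even refl
nimValues-below 0ℙ 1ℙ edge odd even {0} _ = edge refl
nimValues-below 0ℙ 1ℙ edge odd even {1} _ = odd refl
nimValues-below 1ℙ 1ℙ edge odd even {0} _ = odd refl
nimValues-below 1ℙ 1ℙ edge odd even {1} _ = edge refl
nimValues-below 1ℙ 1ℙ edge odd even {2} _ = even refl
nimValues-below 1ℙ 0ℙ edge odd even {suc _} (s≤s ())
nimValues-below 0ℙ 1ℙ edge odd even {suc (suc _)} (s≤s (s≤s ()))
nimValues-below 1ℙ 1ℙ edge odd even {suc (suc (suc _))} (s≤s (s≤s (s≤s ())))

mex≡nimValue : ∀ p q xs →
  All (λ x → (∃ λ r → x ≡ nimValue (p ⁻¹) r) ⊎ x ≡ nimValue p (q ⁻¹)) xs →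
  (q ≡ 1ℙ → nimValue p (q ⁻¹) ∈ xs) →
  (q ≡ 1ℙ → nimValue (p ⁻¹) (q ⊕ 1ℙ) ∈ xs) →
  (p ≡ 1ℙ → nimValue (p ⁻¹) (q ⊕ 0ℙ) ∈ xs) →
  nimValue p q ≤ length xs → mex xs ≡ nimValue p q
mex≡nimValue p q xs options edge odd even bounded =
  mex-≡ xs (nimValue p q) (nimValues-below p q edge odd even) notOption bounded
  where
  notOption : nimValue p q ∉ xs
  notOption t∈xs with All.lookup options t∈xs
  ... | inj₁ (r , eq) = p≢p⁻¹ p (,-injectiveˡ (nimValue-injective {p} {q} {p ⁻¹} {r} eq))
  ... | inj₂ eq = p≢p⁻¹ q (,-injectiveʳ (nimValue-injective {p} {q} {p} {q ⁻¹} eq))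

δ : ∀ {n} → Fin n → Fin n → Parity
δ zero    zero    = 1ℙ
δ zero    (suc _) = 0ℙ
δ (suc _) zero    = 0ℙ
δ (suc k) (suc i) = δ k i

δ-refl : ∀ {n} (i : Fin n) → δ i i ≡ 1ℙ
δ-refl zero    = refl
δ-refl (suc i) = δ-refl i

δ-≢ : ∀ {n} {k i : Fin n} → k ≢ i → δ k i ≡ 0ℙ
δ-≢ {k = zero}  {zero}  k≢i = ⊥-elim (k≢i refl)
δ-≢ {k = zero}  {suc _} _   = refl
δ-≢ {k = suc _} {zero}  _   = refl
δ-≢ {k = suc _} {suc _} k≢i = δ-≢ (k≢i ∘ cong suc)

∑-one : ∀ n → ∑[ k < n ] 1ℙ ≡ parity n
∑-one zero    = refl
∑-one (suc n) = trans (cong _⁻¹ (∑-one n)) (sym (parity-suc n))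

∑-δ : ∀ {n} (w : Fin n → Parity) (i : Fin n) → ∑[ k < n ] (w k · δ k i) ≡ w i
∑-δ {suc n} w zero = begin
  w zero · 1ℙ ⊕ ∑[ k < n ] (w (suc k) · 0ℙ)
    ≡⟨ cong₂ _⊕_ (ℙ.*-identityʳ (w zero))
                 (trans (sum-cong-≗ (ℙ.*-zeroʳ ∘ w ∘ suc)) (sum-replicate-zero n)) ⟩
  w zero ⊕ 0ℙ
    ≡⟨ ℙ.+-identityʳ (w zero) ⟩
  w zero ∎
  where open ≡-Reasoning
∑-δ {suc n} w (suc i) =
  trans (cong (_⊕ ∑[ k < n ] (w (suc k) · δ k i)) (ℙ.*-zeroʳ (w zero))) (∑-δ (w ∘ suc) i)

Loopless : ∀ {n} → Fin n × Fin n → Set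
Loopless (i , j) = i ≢ j

ProperEdge : ∀ {n} → (Fin n → Bool) → Fin n × Fin n → Set
ProperEdge c (i , j) = c i ≢ c j

degree : ∀ {n} → Fin (suc n) → Edges (suc n) → ℕ
degree k [] = 0
degree k (e ∷ es) with dropE k e
... | just _  = degree k es
... | nothing = suc (degree k es)

length-deleteVertex : ∀ {n} (k : Fin (suc n)) es →
  length (deleteVertex k es) + degree k es ≡ length es
length-deleteVertex k [] = refl
length-deleteVertex k (e ∷ es) with dropE k e
... | just _  = cong suc (length-deleteVertex k es)
... | nothing = trans (+-suc _ _) (cong suc (length-deleteVertex k es))

parity-deleteVertex : ∀ {n} (k : Fin (suc n)) es →
  parity (length (deleteVertex k es)) ≡ parity (length es) ⊕ parity (degree k es)
parity-deleteVertex k es = begin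
  v                  ≡⟨ ℙ.+-identityʳ v ⟨
  v ⊕ 0ℙ             ≡⟨ cong (v ⊕_) (p+p≡0ℙ d) ⟨
  v ⊕ (d ⊕ d)        ≡⟨ ℙ.+-assoc v d d ⟨
  v ⊕ d ⊕ d          ≡⟨ cong (_⊕ d) (+-homo-+ (length (deleteVertex k es)) (degree k es)) ⟨
  parity (length (deleteVertex k es) + degree k es) ⊕ d
                     ≡⟨ cong (λ m → parity m ⊕ d) (length-deleteVertex k es) ⟩
  parity (length es) ⊕ d ∎
  where
  open ≡-Reasoning
  v = parity (length (deleteVertex k es))
  d = parity (degree k es)

parity-degree-∷ : ∀ {n} (k : Fin (suc n)) {i j} es → i ≢ j →
  parity (degree k ((i , j) ∷ es)) ≡ δ k i ⊕ δ k j ⊕ parity (degree k es)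
parity-degree-∷ k {i} {j} es i≢j with k ≟ i | k ≟ j
... | yes refl | yes refl = ⊥-elim (i≢j refl)
... | yes refl | no k≢j rewrite δ-refl k | δ-≢ k≢j = parity-suc (degree k es)
... | no k≢i | yes refl rewrite δ-refl k | δ-≢ k≢i = parity-suc (degree k es)
... | no k≢i | no k≢j rewrite δ-≢ k≢i | δ-≢ k≢j = refl

edgeWeight : ∀ {n} → (Fin n → Parity) → Edges n → Parity
edgeWeight w [] = 0ℙ
edgeWeight w ((i , j) ∷ es) = w i ⊕ w j ⊕ edgeWeight w es

∑-weighted-degree : ∀ {n} (w : Fin (suc n) → Parity) es → All Loopless es →
  ∑[ k < suc n ] (w k · parity (degree k es)) ≡ edgeWeight w es
∑-weighted-degree {n} w [] [] = trans (sum-cong-≗ (ℙ.*-zeroʳ ∘ w)) (sum-replicate-zero (suc n))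
∑-weighted-degree {n} w ((i , j) ∷ es) (i≢j ∷ loopless) = begin
  ∑[ k < suc n ] (w k · parity (degree k ((i , j) ∷ es)))
    ≡⟨ sum-cong-≗ (λ k → trans (cong (w k ·_) (parity-degree-∷ k es i≢j))
                                (distrib (w k) (δ k i) (δ k j) (parity (degree k es)))) ⟩
  ∑[ k < suc n ] (w k · δ k i ⊕ w k · δ k j ⊕ w k · parity (degree k es))
    ≡⟨ ∑-distrib-+ (λ k → w k · δ k i ⊕ w k · δ k j) (λ k → w k · parity (degree k es)) ⟩
  ∑[ k < suc n ] (w k · δ k i ⊕ w k · δ k j) ⊕ ∑[ k < suc n ] (w k · parity (degree k es))
    ≡⟨ cong₂ _⊕_ (trans (∑-distrib-+ (λ k → w k · δ k i) (λ k → w k · δ k j))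
                        (cong₂ _⊕_ (∑-δ w i) (∑-δ w j)))
                 (∑-weighted-degree w es loopless) ⟩
  w i ⊕ w j ⊕ edgeWeight w es ∎
  where
  open ≡-Reasoning
  distrib : ∀ x a b c → x · (a ⊕ b ⊕ c) ≡ x · a ⊕ x · b ⊕ x · c
  distrib x a b c = trans (ℙ.*-distribˡ-+ x (a ⊕ b) c) (cong (_⊕ x · c) (ℙ.*-distribˡ-+ x a b))

edgeWeight-1ℙ : ∀ {n} (es : Edges n) → edgeWeight (λ _ → 1ℙ) es ≡ 0ℙ
edgeWeight-1ℙ [] = refl
edgeWeight-1ℙ (_ ∷ es) = edgeWeight-1ℙ es

∑-parity-degree : ∀ {n} (es : Edges (suc n)) → All Loopless es →
  ∑[ k < suc n ] parity (degree k es) ≡ 0ℙ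
∑-parity-degree es loopless = trans (∑-weighted-degree (λ _ → 1ℙ) es loopless) (edgeWeight-1ℙ es)

bipartite⇒loopless : ∀ {n} {es : Edges n} → Bipartite es → All Loopless es
bipartite⇒loopless (c , proper) = All.map (λ ci≢cj i≡j → ci≢cj (cong c i≡j)) proper

toParity : Bool → Parity
toParity false = 0ℙ
toParity true  = 1ℙ

edgeWeight-colouring : ∀ {n} (c : Fin n → Bool) es → All (ProperEdge c) es →
  edgeWeight (toParity ∘ c) es ≡ parity (length es)
edgeWeight-colouring c [] [] = refl
edgeWeight-colouring c ((i , j) ∷ es) (ci≢cj ∷ proper) = begin
  toParity (c i) ⊕ toParity (c j) ⊕ edgeWeight (toParity ∘ c) es
    ≡⟨ cong₂ _⊕_ (different ci≢cj) (edgeWeight-colouring c es proper) ⟩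
  1ℙ ⊕ parity (length es)
    ≡⟨ parity-suc (length es) ⟨
  parity (suc (length es)) ∎
  where
  open ≡-Reasoning
  different : ∀ {a b} → a ≢ b → toParity a ⊕ toParity b ≡ 1ℙ
  different {false} {false} a≢b = ⊥-elim (a≢b refl)
  different {false} {true}  _   = refl
  different {true}  {false} _   = refl
  different {true}  {true}  a≢b = ⊥-elim (a≢b refl)

∃-with-parity : ∀ {n} (f : Fin n → Parity) p → ¬ (∀ k → f k ≡ p ⁻¹) → ∃ λ k → f k ≡ p
∃-with-parity {n} f p notAll with ¬∀⟶∃¬ n _ (λ k → f k ℙ.≟ p ⁻¹) notAll
... | k , fk≢p⁻¹ = k , other (f k) p fk≢p⁻¹
  where
  other : ∀ x p → x ≢ p ⁻¹ → x ≡ p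
  other 0ℙ 0ℙ _ = refl
  other 1ℙ 1ℙ _ = refl
  other 0ℙ 1ℙ x≢ = ⊥-elim (x≢ refl)
  other 1ℙ 0ℙ x≢ = ⊥-elim (x≢ refl)

even-degree-vertex : ∀ {n} (es : Edges (suc n)) → All Loopless es → parity (suc n) ≡ 1ℙ →
  ∃ λ k → parity (degree k es) ≡ 0ℙ
even-degree-vertex {n} es loopless oddOrder = ∃-with-parity _ 0ℙ λ allOdd → p≢p⁻¹ 0ℙ (begin
  0ℙ                                  ≡⟨ ∑-parity-degree es loopless ⟨
  ∑[ k < suc n ] parity (degree k es) ≡⟨ sum-cong-≗ allOdd ⟩
  ∑[ k < suc n ] 1ℙ                   ≡⟨ ∑-one (suc n) ⟩
  parity (suc n)                      ≡⟨ oddOrder ⟩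
  1ℙ                                  ∎)
  where
  open ≡-Reasoning

odd-degree-vertex : ∀ {n} (c : Fin (suc n) → Bool) es → All (ProperEdge c) es →
  parity (length es) ≡ 1ℙ → ∃ λ k → parity (degree k es) ≡ 1ℙ
odd-degree-vertex {n} c es proper oddSize = ∃-with-parity _ 1ℙ λ allEven → p≢p⁻¹ 0ℙ (begin
  0ℙ
    ≡⟨ sum-replicate-zero (suc n) ⟨
  ∑[ k < suc n ] 0ℙ
    ≡⟨ sum-cong-≗ (λ k → trans (sym (ℙ.*-zeroʳ (toParity (c k))))
                               (cong (toParity (c k) ·_) (sym (allEven k)))) ⟩
  ∑[ k < suc n ] (toParity (c k) · parity (degree k es))
    ≡⟨ ∑-weighted-degree (toParity ∘ c) es (bipartite⇒loopless (c , proper)) ⟩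
  edgeWeight (toParity ∘ c) es
    ≡⟨ edgeWeight-colouring c es proper ⟩
  parity (length es)
    ≡⟨ oddSize ⟩
  1ℙ ∎)
  where open ≡-Reasoning

dropE-proper : ∀ {n} (k : Fin (suc n)) {c : Fin (suc n) → Bool} e → ProperEdge c e →
  Maybe.All (ProperEdge (c ∘ punchIn k)) (dropE k e)
dropE-proper k {c} (i , j) ci≢cj with k ≟ i | k ≟ j
... | yes _   | _       = Maybe.nothing
... | no _    | yes _   = Maybe.nothing
... | no k≢i  | no k≢j  = Maybe.just λ eq →
  ci≢cj (subst₂ (λ a b → c a ≡ c b) (punchIn-punchOut k≢i) (punchIn-punchOut k≢j) eq)

deleteVertex-bipartite : ∀ {n} (k : Fin (suc n)) {es} →
  Bipartite es → Bipartite (deleteVertex k es)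
deleteVertex-bipartite k (c , proper) =
  c ∘ punchIn k , All.mapMaybe⁺ (All.map⁺ (All.map (dropE-proper k _) proper))

module _ {A : Set} where

  removals-All : ∀ {P : A → Set} {xs r} → All P xs → r ∈ removals xs → All P r
  removals-All (_  ∷ pxs) (here refl) = pxs
  removals-All {xs = x ∷ xs} (px ∷ pxs) (there r∈) with ∈-map⁻ (x ∷_) r∈
  ... | r′ , r′∈ , refl = px ∷ removals-All pxs r′∈

  removals-length : ∀ {xs r : List A} → r ∈ removals xs → suc (length r) ≡ length xs
  removals-length {x ∷ xs} (here refl) = refl
  removals-length {x ∷ xs} (there r∈) with ∈-map⁻ (x ∷_) r∈
  ... | r′ , r′∈ , refl = cong suc (removals-length r′∈)

  length-removals : ∀ (xs : List A) → length (removals xs) ≡ length xs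
  length-removals [] = refl
  length-removals (x ∷ xs) =
    cong suc (trans (length-map (x ∷_) (removals xs)) (length-removals xs))

  removal-of-odd : ∀ (xs : List A) → parity (length xs) ≡ 1ℙ → ∃ λ r → r ∈ removals xs
  removal-of-odd []       ()
  removal-of-odd (x ∷ xs) _ = xs , here refl

removals-bipartite : ∀ {n} {es r : Edges n} → Bipartite es → r ∈ removals es → Bipartite r
removals-bipartite (c , proper) r∈ = c , removals-All proper r∈

loopless-Fin1 : (es : Edges 1) → All Loopless es → es ≡ []
loopless-Fin1 [] [] = refl
loopless-Fin1 ((zero , zero) ∷ _) (0≢0 ∷ _) = ⊥-elim (0≢0 refl)

nimValue≤order+size : ∀ m (es : Edges (suc m)) → All Loopless es →
  nimValue (parity (suc m)) (parity (length es)) ≤ suc m + length es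
nimValue≤order+size zero es loopless rewrite loopless-Fin1 es loopless = ≤-refl
nimValue≤order+size (suc m) es _ =
  ≤-trans (nimValue-parity≤2+n (parity (suc (suc m))) (length es))
          (+-monoˡ-≤ (length es) (s≤s (s≤s z≤n)))

nimF-bipartite : ∀ fuel n (es : Edges n) → n + length es < fuel → Bipartite es →
  nimF fuel n es ≡ nimValue (parity n) (parity (length es))
nimF-bipartite (suc fuel) zero [] _ _ = refl
nimF-bipartite (suc fuel) (suc m) es (s≤s m+e<fuel) bip@(c , proper) =
  mex≡nimValue p q options classified edgeMove oddVertexMove evenVertexMove bounded
  where
  p = parity (suc m)
  q = parity (length es)

  vertexValue : Fin (suc m) → ℕ
  vertexValue k = nimF fuel m (deleteVertex k es)

  edgeValue : Edges (suc m) → ℕ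
  edgeValue = nimF fuel (suc m)

  options : List ℕ
  options = map vertexValue (allFin (suc m)) ++ map edgeValue (removals es)

  vertexValue≡ : ∀ k → vertexValue k ≡ nimValue (p ⁻¹) (q ⊕ parity (degree k es))
  vertexValue≡ k =
    trans (nimF-bipartite fuel m (deleteVertex k es) smaller (deleteVertex-bipartite k bip))
          (cong₂ nimValue (sym (suc-homo-⁻¹ m)) (parity-deleteVertex k es))
    where
    deleted≤ : length (deleteVertex k es) ≤ length es
    deleted≤ = subst (length (deleteVertex k es) ≤_) (length-deleteVertex k es)
                 (m≤m+n (length (deleteVertex k es)) (degree k es))
    smaller : m + length (deleteVertex k es) < fuel
    smaller = ≤-<-trans (+-monoʳ-≤ m deleted≤) m+e<fuel

  edgeValue≡ : ∀ {r} → r ∈ removals es → edgeValue r ≡ nimValue p (q ⁻¹)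
  edgeValue≡ {r} r∈ =
    trans (nimF-bipartite fuel (suc m) r smaller (removals-bipartite bip r∈))
          (cong (nimValue p) (trans (sym (suc-homo-⁻¹ (length r)))
                                    (cong (λ l → parity l ⁻¹) (removals-length r∈))))
    where
    smaller : suc m + length r < fuel
    smaller = subst (_< fuel) (+-suc m (length r))
                (subst (λ l → m + l < fuel) (sym (removals-length r∈)) m+e<fuel)

  classified : All (λ x → (∃ λ r → x ≡ nimValue (p ⁻¹) r) ⊎ x ≡ nimValue p (q ⁻¹)) options
  classified =
    All.++⁺ (All.map⁺ (All.tabulate⁺ λ k → inj₁ (q ⊕ parity (degree k es) , vertexValue≡ k)))
            (All.map⁺ (All.tabulate λ r∈ → inj₂ (edgeValue≡ r∈)))

  vertexMove : ∀ k {d} → parity (degree k es) ≡ d → nimValue (p ⁻¹) (q ⊕ d) ∈ options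
  vertexMove k refl =
    subst (_∈ options) (vertexValue≡ k) (∈-++⁺ˡ (∈-map⁺ vertexValue (∈-allFin k)))

  edgeMove : q ≡ 1ℙ → nimValue p (q ⁻¹) ∈ options
  edgeMove oddSize with removal-of-odd es oddSize
  ... | r , r∈ = subst (_∈ options) (edgeValue≡ r∈) (∈-++⁺ʳ _ (∈-map⁺ edgeValue r∈))

  oddVertexMove : q ≡ 1ℙ → nimValue (p ⁻¹) (q ⊕ 1ℙ) ∈ options
  oddVertexMove oddSize with odd-degree-vertex c es proper oddSize
  ... | k , odd = vertexMove k odd

  evenVertexMove : p ≡ 1ℙ → nimValue (p ⁻¹) (q ⊕ 0ℙ) ∈ options
  evenVertexMove oddOrder with even-degree-vertex es (bipartite⇒loopless bip) oddOrder
  ... | k , even = vertexMove k even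

  length-options : length options ≡ suc m + length es
  length-options = begin
    length options
      ≡⟨ length-++ (map vertexValue (allFin (suc m))) ⟩
    length (map vertexValue (allFin (suc m))) + length (map edgeValue (removals es))
      ≡⟨ cong₂ _+_ (trans (length-map vertexValue (allFin (suc m))) (length-tabulate (λ k → k)))
                   (trans (length-map edgeValue (removals es)) (length-removals es)) ⟩
    suc m + length es ∎
    where open ≡-Reasoning

  bounded : nimValue p q ≤ length options
  bounded = subst (nimValue p q ≤_) (sym length-options)
              (nimValue≤order+size m es (bipartite⇒loopless bip))

theorem3 : (n : ℕ) (es : Edges n) → Simple es → Bipartite es →
    nim n es ≡ n % 2 + 2 * (length es % 2)
theorem3 n es _ bip = begin
  nim n es
    ≡⟨ nimF-bipartite (suc (n + length es)) n es ≤-refl bip ⟩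
  nimValue (parity n) (parity (length es))
    ≡⟨ cong₂ (λ a b → a + 2 * b) (bit-parity n) (bit-parity (length es)) ⟩
  n % 2 + 2 * (length es % 2) ∎
  where open ≡-Reasoning
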